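{- Let $\alpha=(\alpha_1,\dots,\alpha_m)$ be a partition of $n$ and $r\in\mathbb{N}$. Then $$\mathbf{C}_\alpha(\mathbf{z})\circ p_1^r=\mathbf{C}_{\alpha^r}(\mathbf{z}),$$ where $\circ$ is plethysm of symmetric functions and $\alpha^r$ is the partition of $nr$ containing exactly $r$ copies of each part $\alpha_i$.
   Context: For a partition $\alpha$ of $n$, let $\sigma_\alpha\in S_n$ be the standard permutation of shape $\alpha$: the product of disjoint cycles $(1,\dots,\alpha_1)(\alpha_1+1,\dots,\alpha_1+\alpha_2)\cdots$ obtained by filling cycles of lengths $\alpha_1,\alpha_2,\dots$ with $1,\dots,n$ in increasing order. Define $\mathbf{C}_\alpha(\mathbf{z}):=\frac{1}{o(\sigma_\alpha)}\sum_{g\in\langle\sigma_\alpha\rangle}p_{\lambda(g)}$, where $o(\cdot)$ is the order of a permutation, $\lambda(g)$ the cycle type of $g$, and $p_\lambda$ the power-sum symmetric function; this is the cycle index series of the molecular species $X^n/\langle\sigma_\alpha\rangle$. -}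

module Defs where

open import Data.Nat using (ℕ; zero; suc; _+_; _*_; _∸_; _<_; _≥_; _<ᵇ_; _≡ᵇ_; _!)
open import Data.Nat.Properties using (≤-decTotalOrder; _≟_)
open import Data.Nat.ListAction using (sum)
open import Data.Bool using (Bool; true; false; if_then_else_; not; T)
open import Data.Bool.Properties using (T?)
open import Data.Bool.ListAction using (all; any)
open import Data.List using (List; []; _∷_; map; upTo; filter; concatMap; replicate; _++_; foldr)
open import Data.List.Relation.Unary.All using (All)
open import Data.List.Relation.Unary.Linked using (Linked)
open import Data.Product using (_×_; _,_)
open import Data.Integer using (+_)
open import Data.Rational as ℚ using (ℚ; 0ℚ; 1ℚ)
open import Relation.Nullary.Decidable using (does)
open import Relation.Binary.PropositionalEquality using (_≡_)
open import Function using (_∘_; id)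

record IsPartitionOf (n : ℕ) (α : List ℕ) : Set where
  field
    positive   : All (0 <_) α
    decreasing : Linked _≥_ α
    total      : sum α ≡ n

_^ᵖ_ : List ℕ → ℕ → List ℕ
α ^ᵖ r = concatMap (replicate r) α

-- Permutations of {0,…,N-1}, represented by functions ℕ → ℕ
-- (only their values on 0,…,N-1 matter).

iter : (ℕ → ℕ) → ℕ → ℕ → ℕ
iter g zero    i = i
iter g (suc k) i = g (iter g k i)

findFirst : ℕ → (ℕ → Bool) → ℕ
findFirst zero    p = zero
findFirst (suc b) p = if p zero then zero else suc (findFirst b (p ∘ suc))

permEqᵇ : ℕ → (ℕ → ℕ) → (ℕ → ℕ) → Bool
permEqᵇ N f h = all (λ i → f i ≡ᵇ h i) (upTo N)

-- order o(g) of a permutation g of {0,…,N-1}: least k ≥ 1 with g^k = id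
-- (it is at most N!, so a search up to N! finds it)
order : (ℕ → ℕ) → ℕ → ℕ
order g N = suc (findFirst (N !) (λ k → permEqᵇ N (iter g (suc k)) id))

cycLen : (ℕ → ℕ) → ℕ → ℕ → ℕ
cycLen g N i = suc (findFirst N (λ k → iter g (suc k) i ≡ᵇ i))

isRepᵇ : (ℕ → ℕ) → ℕ → ℕ → Bool
isRepᵇ g N i = not (any (λ k → iter g k i <ᵇ i) (upTo N))

cycleType : (ℕ → ℕ) → ℕ → List ℕ
cycleType g N = map (cycLen g N) (filter (λ i → T? (isRepᵇ g N i)) (upTo N))

-- standard permutation σ_α (0-based): cycles (0,…,α₁-1)(α₁,…,α₁+α₂-1)…
stdPerm : List ℕ → ℕ → ℕ
stdPerm []      i = i
stdPerm (a ∷ α) i =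
  if i <ᵇ a then (if suc i <ᵇ a then suc i else zero)
            else a + stdPerm α (i ∸ a)

-- Symmetric functions over ℚ in the power-sum basis:
-- a finite formal sum Σ c · p_λ, a term being (c , λ) with λ a list of
-- positive integers (a multiset; the order of the parts is irrelevant).

Sym : Set
Sym = List (ℚ × List ℕ)

pw : List ℕ → Sym
pw λ′ = (1ℚ , λ′) ∷ []

one : Sym
one = pw []

_⊕_ : Sym → Sym → Sym
f ⊕ g = f ++ g

scale : ℚ → Sym → Sym
scale c = map (λ { (d , μ) → (c ℚ.* d , μ) })

_⊗_ : Sym → Sym → Sym
f ⊗ g = concatMap (λ { (c , λ′) → map (λ { (d , μ) → (c ℚ.* d , λ′ ++ μ) }) g }) f

mult : ℕ → List ℕ → ℕ
mult k []      = zero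
mult k (x ∷ xs) = if k ≡ᵇ x then suc (mult k xs) else mult k xs

sameMultisetᵇ : List ℕ → List ℕ → Bool
sameMultisetᵇ λ′ μ = all (λ k → mult k λ′ ≡ᵇ mult k μ) (λ′ ++ μ)

coeff : List ℕ → Sym → ℚ
coeff μ f = foldr (λ { (c , λ′) acc →
  if sameMultisetᵇ λ′ μ then c ℚ.+ acc else acc }) 0ℚ f

-- equality of symmetric functions (p_λ form a basis)
_≈_ : Sym → Sym → Set
f ≈ g = ∀ μ → coeff μ f ≡ coeff μ g

-- plethysm:  p_k ∘ g = g with every p_j replaced by p_{kj};
-- f ↦ f ∘ g is the ℚ-algebra map with p_k ↦ p_k ∘ g.
pk∘ : ℕ → Sym → Sym
pk∘ k = map (λ { (c , μ) → (c , map (k *_) μ) })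

pλ∘ : List ℕ → Sym → Sym
pλ∘ λ′ g = foldr (λ k acc → pk∘ k g ⊗ acc) one λ′

_∘ₚ_ : Sym → Sym → Sym
f ∘ₚ g = concatMap (λ { (c , λ′) → scale c (pλ∘ λ′ g) }) f

p1^ : ℕ → Sym
p1^ r = pw (replicate r 1)

-- Cycle index C_α = (1/o(σ_α)) Σ_{g ∈ ⟨σ_α⟩} p_{λ(g)},
-- the group ⟨σ_α⟩ being enumerated as σ_α^k, 0 ≤ k < o(σ_α).

inv : ℕ → ℚ
inv zero    = 0ℚ
inv (suc m) = (+ 1) ℚ./ suc m

C : List ℕ → Sym
C α = map (λ k → (inv o , cycleType (iter σ k) N)) (upTo o)
  where
    N = sum α
    σ = stdPerm α
    o = order σ N

-- Plethysm with p₁ʳ sends p_λ to p_{λʳ}, so C_α ∘ p₁ʳ is the average over k < o(σ_α) of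
-- p_{λ(σ_α^k)ʳ}.  Since σ_α is a block sum of rotations of lengths α₁, α₂, …, the cycle type of
-- σ_α^k is the concatenation of the cycle types of the k-th powers of these rotations; σ_{αʳ}^k
-- has each block repeated r times, so λ(σ_α^k)ʳ and λ(σ_{αʳ}^k) are the same multiset.  For
-- r ≥ 1 the same rotations occur in σ_α and σ_{αʳ}, so both have the same order and the two
-- averages agree term by term.  For r = 0 both sides equal p_∅ = 1, though o(σ_α) need not be 1.

module Submission where

open import Defs
open import Data.Bool using (Bool; true; false; if_then_else_; not; T; _∧_)
open import Data.Bool.ListAction using (all; any; or)
open import Data.Bool.Properties using (T?; T-≡; T-∧; ∧-assoc; ∧-identityʳ; ∧-idem)
open import Data.Empty using (⊥-elim)
open import Data.List using (List; []; _∷_; [_]; map; upTo; applyUpTo; filter; concatMap; replicate; _++_; length)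
open import Data.List.Membership.Propositional using (_∉_)
open import Data.List.Membership.Propositional.Properties using (∈-++⁺ˡ; ∈-++⁺ʳ)
open import Data.List.Properties using (length-applyUpTo; map-cong; map-∘; map-++; filter-++; concatMap-++; concatMap-pure; map-replicate)
open import Data.List.Relation.Unary.All as All using (All; []; _∷_)
open import Data.List.Relation.Unary.All.Properties using (all⁺; all⁻; applyUpTo⁺₁; concat⁺; map⁺; replicate⁺)
open import Data.List.Relation.Unary.Any using (here; there)
open import Data.List.Relation.Unary.Any.Properties using (any⁺; any⁻; applyUpTo⁺; applyUpTo⁻)
open import Data.Nat using (ℕ; zero; suc; pred; _+_; _*_; _∸_; _<_; _≤_; _<ᵇ_; _≡ᵇ_; _!; z<s; s<s; s≤s; NonZero)
open import Data.Nat.Properties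
open import Data.List.Membership.DecPropositional _≟_ using (_∈?_)
open import Data.Nat.DivMod using (_%_; _/_; m≡m%n+[m/n]*n; m%n<n; m%n%n≡m%n; m<n⇒m%n≡m; n%n≡0; [m+n]%n≡m%n; [m+kn]%n≡m%n; %-distribˡ-+)
open import Data.Nat.Divisibility using (_∣_; divides; ∣-trans; m∣m*n; ∣⇒≤; m≤n⇒m!∣n!)
open import Data.Nat.ListAction using (sum)
open import Data.Nat.ListAction.Properties using (sum-++)
import Data.Integer as ℤ
import Data.Integer.Properties as ℤP
open import Data.Nat.Coprimality using (1-coprimeTo) renaming (sym to coprime-sym)
open import Data.Rational as ℚ using (0ℚ; 1ℚ)
open import Data.Rational.Literals using (fromℤ)
import Data.Rational.Properties as ℚP
open import Data.Product using (_×_; _,_; ∃-syntax; map₂)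
open import Data.Unit using (tt)
open import Function using (_∘_; id; _⇔_; mk⇔; Equivalence)
open import Relation.Binary.PropositionalEquality using (_≡_; _≗_; refl; sym; trans; cong; cong₂; subst; module ≡-Reasoning)
open import Relation.Nullary using (yes; no; contradiction)
open import Relation.Nullary.Decidable using (dec-true; dec-false)
open ≡-Reasoning

T-injective : ∀ {x y} → T x ⇔ T y → x ≡ y
T-injective {false} {false} _ = refl
T-injective {false} {true}  h = ⊥-elim (Equivalence.from h tt)
T-injective {true}  {false} h = ⊥-elim (Equivalence.to h tt)
T-injective {true}  {true}  _ = refl

+-≡ᵇ : ∀ c m n → (c + m ≡ᵇ c + n) ≡ (m ≡ᵇ n)
+-≡ᵇ zero    m n = refl
+-≡ᵇ (suc c) m n = +-≡ᵇ c m n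

+-<ᵇ : ∀ c m n → (c + m <ᵇ c + n) ≡ (m <ᵇ n)
+-<ᵇ zero    m n = refl
+-<ᵇ (suc c) m n = +-<ᵇ c m n

all-++ : ∀ {A : Set} (p : A → Bool) xs ys → all p (xs ++ ys) ≡ all p xs ∧ all p ys
all-++ p []       ys = refl
all-++ p (x ∷ xs) ys = trans (cong (p x ∧_) (all-++ p xs ys)) (sym (∧-assoc (p x) _ _))

all-applyUpTo-cong : ∀ {p q : ℕ → Bool} s t n → (∀ {j} → j < n → p (s j) ≡ q (t j)) →
                     all p (applyUpTo s n) ≡ all q (applyUpTo t n)
all-applyUpTo-cong s t zero    e = refl
all-applyUpTo-cong s t (suc n) e = cong₂ _∧_ (e z<s) (all-applyUpTo-cong (s ∘ suc) (t ∘ suc) n (e ∘ s<s))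

map-filter-applyUpTo-cong : ∀ {f f′ : ℕ → ℕ} {b b′ : ℕ → Bool} s s′ n →
  (∀ {j} → j < n → b (s j) ≡ b′ (s′ j) × f (s j) ≡ f′ (s′ j)) →
  map f (filter (T? ∘ b) (applyUpTo s n)) ≡ map f′ (filter (T? ∘ b′) (applyUpTo s′ n))
map-filter-applyUpTo-cong s s′ zero e = refl
map-filter-applyUpTo-cong {b = b} {b′} s s′ (suc n) e with b (s 0) | b′ (s′ 0) | e z<s
... | true  | .true  | refl , fs≡f′s′ =
  cong₂ _∷_ fs≡f′s′ (map-filter-applyUpTo-cong (s ∘ suc) (s′ ∘ suc) n (e ∘ s<s))
... | false | .false | refl , _ = map-filter-applyUpTo-cong (s ∘ suc) (s′ ∘ suc) n (e ∘ s<s)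

applyUpTo-+ : ∀ {A : Set} (f : ℕ → A) a n → applyUpTo f (a + n) ≡ applyUpTo f a ++ applyUpTo (f ∘ (a +_)) n
applyUpTo-+ f zero    n = refl
applyUpTo-+ f (suc a) n = cong (f 0 ∷_) (applyUpTo-+ (f ∘ suc) a n)

-- Iterates and cycle data

iter-+ : ∀ g m n i → iter g (m + n) i ≡ iter g m (iter g n i)
iter-+ g zero    n i = refl
iter-+ g (suc m) n i = cong g (iter-+ g m n i)

iter-* : ∀ g j k i → iter (iter g k) j i ≡ iter g (j * k) i
iter-* g zero    k i = refl
iter-* g (suc j) k i = trans (cong (iter g k) (iter-* g j k i)) (sym (iter-+ g k (j * k) i))

iter-cong : ∀ {f g} → f ≗ g → ∀ k → iter f k ≗ iter g k
iter-cong f≗g zero    i = refl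
iter-cong {f} {g} f≗g (suc k) i = trans (cong f (iter-cong f≗g k i)) (f≗g (iter g k i))

iter-fixed : ∀ {g i} → g i ≡ i → ∀ k → iter g k i ≡ i
iter-fixed gi≡i zero    = refl
iter-fixed {g} gi≡i (suc k) = trans (cong g (iter-fixed gi≡i k)) gi≡i

iter-closed : ∀ {g N} → (∀ {i} → i < N → g i < N) → ∀ k {i} → i < N → iter g k i < N
iter-closed closed zero    i<N = i<N
iter-closed closed (suc k) i<N = closed (iter-closed closed k i<N)

iter-%-period : ∀ {g p i} → iter g (suc p) i ≡ i → ∀ j → iter g j i ≡ iter g (j % suc p) i
iter-%-period {g} {p} {i} e j = begin
    iter g j i
  ≡⟨ cong (λ t → iter g t i) (m≡m%n+[m/n]*n j (suc p)) ⟩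
    iter g (j % suc p + j / suc p * suc p) i
  ≡⟨ iter-+ g (j % suc p) _ i ⟩
    iter g (j % suc p) (iter g (j / suc p * suc p) i)
  ≡⟨ cong (iter g (j % suc p)) (iter-* g (j / suc p) (suc p) i) ⟨
    iter g (j % suc p) (iter (iter g (suc p)) (j / suc p) i)
  ≡⟨ cong (iter g (j % suc p)) (iter-fixed e (j / suc p)) ⟩
    iter g (j % suc p) i
  ∎

findFirst-cong : ∀ b {p q : ℕ → Bool} → p ≗ q → findFirst b p ≡ findFirst b q
findFirst-cong zero    p≗q = refl
findFirst-cong (suc b) {p} {q} p≗q rewrite p≗q 0 =
  cong (λ n → if q 0 then 0 else suc n) (findFirst-cong b (p≗q ∘ suc))

findFirst-extend : ∀ {b b′ j} (p : ℕ → Bool) → j < b → T (p j) → b ≤ b′ → findFirst b′ p ≡ findFirst b p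
findFirst-extend {suc b} {suc b′} p j<b pj b≤b′ with p 0 in p0
... | true = refl
findFirst-extend {suc b} {suc b′} {zero}  p _ pj _ | false = ⊥-elim (subst T p0 pj)
findFirst-extend {suc b} {suc b′} {suc j} p (s<s j<b) pj (s≤s b≤b′) | false =
  cong suc (findFirst-extend (p ∘ suc) j<b pj b≤b′)

cycLen-shift : ∀ {f g} c N {i} → (∀ k → iter f k (c + i) ≡ c + iter g k i) →
               cycLen f N (c + i) ≡ cycLen g N i
cycLen-shift c N {i} orbit =
  cong suc (findFirst-cong N λ k → trans (cong (_≡ᵇ c + i) (orbit (suc k))) (+-≡ᵇ c _ i))

isRepᵇ-shift : ∀ {f g} c N {i} → (∀ k → iter f k (c + i) ≡ c + iter g k i) →
               isRepᵇ f N (c + i) ≡ isRepᵇ g N i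
isRepᵇ-shift c N {i} orbit =
  cong (not ∘ or) (map-cong (λ k → trans (cong (_<ᵇ c + i) (orbit k)) (+-<ᵇ c _ i)) (upTo N))

cycLen-extend : ∀ g {N N′ i p} → p < N → iter g (suc p) i ≡ i → N ≤ N′ → cycLen g N′ i ≡ cycLen g N i
cycLen-extend g {i = i} p<N e N≤N′ =
  cong suc (findFirst-extend (λ k → iter g (suc k) i ≡ᵇ i) p<N (≡⇒≡ᵇ _ _ e) N≤N′)

isRepᵇ-extend : ∀ g {N N′ i p} → p < N → iter g (suc p) i ≡ i → N ≤ N′ → isRepᵇ g N′ i ≡ isRepᵇ g N i
isRepᵇ-extend g {N} {N′} {i} {p} p<N e N≤N′ = cong not (T-injective (mk⇔ shrink grow))
  where
  dips : ℕ → Bool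
  dips k = iter g k i <ᵇ i
  shrink : T (any dips (upTo N′)) → T (any dips (upTo N))
  shrink h with applyUpTo⁻ id (any⁻ dips (upTo N′) h)
  ... | j , _ , dj = any⁺ dips (applyUpTo⁺ id (subst (λ x → T (x <ᵇ i)) (iter-%-period e j) dj)
                                              (<-≤-trans (m%n<n j (suc p)) p<N))
  grow : T (any dips (upTo N)) → T (any dips (upTo N′))
  grow h with applyUpTo⁻ id (any⁻ dips (upTo N) h)
  ... | j , j<N , dj = any⁺ dips (applyUpTo⁺ id dj (<-≤-trans j<N N≤N′))

-- Permutations of {0,…,N-1} and block sums

-- For finite N this says that g restricts to a permutation of {0,…,N-1}; the bound p < N on
-- the periods is what lets cycLen and isRepᵇ, whose searches stop at N, see whole cycles.
record Permutes (N : ℕ) (g : ℕ → ℕ) : Set where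
  field
    closed   : ∀ {i} → i < N → g i < N
    periodic : ∀ {i} → i < N → ∃[ p ] p < N × iter g (suc p) i ≡ i

open Permutes

Permutes-iter : ∀ {N g} → Permutes N g → ∀ k → Permutes N (iter g k)
Permutes-iter pg k .closed = iter-closed (pg .closed) k
Permutes-iter {g = g} pg k .periodic {i} i<N with pg .periodic i<N
... | p , p<N , e = p , p<N , (begin
  iter (iter g k) (suc p) i   ≡⟨ iter-* g (suc p) k i ⟩
  iter g (suc p * k) i        ≡⟨ cong (λ t → iter g t i) (*-comm (suc p) k) ⟩
  iter g (k * suc p) i        ≡⟨ iter-* g k (suc p) i ⟨
  iter (iter g (suc p)) k i   ≡⟨ iter-fixed e k ⟩
  i                           ∎)

data Split (a : ℕ) : ℕ → Set where
  below : ∀ {i} → i < a → Split a i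
  above : ∀ x → Split a (a + x)

split : ∀ a i → Split a i
split zero    i       = above i
split (suc a) zero    = below z<s
split (suc a) (suc i) with split a i
... | below i<a = below (s<s i<a)
... | above x   = above x

blockSum : ℕ → (ℕ → ℕ) → (ℕ → ℕ) → ℕ → ℕ
blockSum a h g i = if i <ᵇ a then h i else a + g (i ∸ a)

blockSum-below : ∀ a h g {i} → i < a → blockSum a h g i ≡ h i
blockSum-below a h g {i} i<a rewrite dec-true (T? (i <ᵇ a)) (<⇒<ᵇ i<a) = refl

blockSum-above : ∀ a h g x → blockSum a h g (a + x) ≡ a + g x
blockSum-above a h g x
  rewrite dec-false (T? (a + x <ᵇ a)) (m+n≮m a x ∘ <ᵇ⇒< (a + x) a) | m+n∸m≡n a x = refl

iter-blockSum-below : ∀ a h g → (∀ {i} → i < a → h i < a) →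
                      ∀ k {i} → i < a → iter (blockSum a h g) k i ≡ iter h k i
iter-blockSum-below a h g closed zero    i<a = refl
iter-blockSum-below a h g closed (suc k) i<a =
  trans (cong (blockSum a h g) (iter-blockSum-below a h g closed k i<a))
        (blockSum-below a h g (iter-closed closed k i<a))

iter-blockSum-above : ∀ a h g k x → iter (blockSum a h g) k (a + x) ≡ a + iter g k x
iter-blockSum-above a h g zero    x = refl
iter-blockSum-above a h g (suc k) x =
  trans (cong (blockSum a h g) (iter-blockSum-above a h g k x)) (blockSum-above a h g _)

iter-blockSum : ∀ a h g → (∀ {i} → i < a → h i < a) →
                ∀ k → iter (blockSum a h g) k ≗ blockSum a (iter h k) (iter g k)
iter-blockSum a h g closed k i with split a i
... | below i<a = trans (iter-blockSum-below a h g closed k i<a)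
                        (sym (blockSum-below a (iter h k) (iter g k) i<a))
... | above x   = trans (iter-blockSum-above a h g k x)
                        (sym (blockSum-above a (iter h k) (iter g k) x))

Permutes-blockSum : ∀ {a M h g} → Permutes a h → Permutes M g → Permutes (a + M) (blockSum a h g)
Permutes-blockSum {a} {M} {h} {g} ph pg .closed {i} i<a+M with split a i
... | below i<a = subst (_< a + M) (sym (blockSum-below a h g i<a))
                        (<-≤-trans (ph .closed i<a) (m≤m+n a M))
... | above x   = subst (_< a + M) (sym (blockSum-above a h g x))
                        (+-monoʳ-< a (pg .closed (+-cancelˡ-< a x M i<a+M)))
Permutes-blockSum {a} {M} {h} {g} ph pg .periodic {i} i<a+M with split a i
... | below i<a with ph .periodic i<a
...   | p , p<a , e =
  p , <-≤-trans p<a (m≤m+n a M) , trans (iter-blockSum-below a h g (ph .closed) (suc p) i<a) e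
Permutes-blockSum {a} {M} {h} {g} ph pg .periodic {i} i<a+M | above x
  with pg .periodic (+-cancelˡ-< a x M i<a+M)
...   | p , p<M , e =
  p , <-≤-trans p<M (m≤n+m M a) , trans (iter-blockSum-above a h g (suc p) x) (cong (a +_) e)

cycleType-≗ : ∀ {f g} N → f ≗ g → cycleType f N ≡ cycleType g N
cycleType-≗ N f≗g = map-filter-applyUpTo-cong id id N λ {j} _ →
  isRepᵇ-shift 0 N (λ k → iter-cong f≗g k j) , cycLen-shift 0 N (λ k → iter-cong f≗g k j)

cycleType-blockSum : ∀ {a M h g} → Permutes a h → Permutes M g →
                     cycleType (blockSum a h g) (a + M) ≡ cycleType h a ++ cycleType g M
cycleType-blockSum {a} {M} {h} {g} ph pg = begin
    map ℓ (filter R (upTo (a + M)))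
  ≡⟨ cong (map ℓ ∘ filter R) (applyUpTo-+ id a M) ⟩
    map ℓ (filter R (upTo a ++ applyUpTo (a +_) M))
  ≡⟨ cong (map ℓ) (filter-++ R (upTo a) _) ⟩
    map ℓ (filter R (upTo a) ++ filter R (applyUpTo (a +_) M))
  ≡⟨ map-++ ℓ (filter R (upTo a)) _ ⟩
    map ℓ (filter R (upTo a)) ++ map ℓ (filter R (applyUpTo (a +_) M))
  ≡⟨ cong₂ _++_ (map-filter-applyUpTo-cong id id a lower)
                (map-filter-applyUpTo-cong (a +_) id M upper) ⟩
    cycleType h a ++ cycleType g M
  ∎
  where
  B = blockSum a h g
  ℓ = cycLen B (a + M)
  R = λ i → T? (isRepᵇ B (a + M) i)
  lower : ∀ {i} → i < a → isRepᵇ B (a + M) i ≡ isRepᵇ h a i × ℓ i ≡ cycLen h a i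
  lower {i} i<a with ph .periodic i<a
  ... | p , p<a , e = trans (isRepᵇ-shift 0 (a + M) orbit) (isRepᵇ-extend h p<a e (m≤m+n a M))
                    , trans (cycLen-shift 0 (a + M) orbit) (cycLen-extend h p<a e (m≤m+n a M))
    where
    orbit : ∀ k → iter B k i ≡ iter h k i
    orbit k = iter-blockSum-below a h g (ph .closed) k i<a
  upper : ∀ {x} → x < M → isRepᵇ B (a + M) (a + x) ≡ isRepᵇ g M x × ℓ (a + x) ≡ cycLen g M x
  upper {x} x<M with pg .periodic x<M
  ... | p , p<M , e = trans (isRepᵇ-shift a (a + M) orbit) (isRepᵇ-extend g p<M e (m≤n+m M a))
                    , trans (cycLen-shift a (a + M) orbit) (cycLen-extend g p<M e (m≤n+m M a))
    where
    orbit : ∀ k → iter B k (a + x) ≡ a + iter g k x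
    orbit k = iter-blockSum-above a h g k x

permEqᵇ-≗ : ∀ {f g} N → f ≗ g → permEqᵇ N f id ≡ permEqᵇ N g id
permEqᵇ-≗ N f≗g = all-applyUpTo-cong id id N λ {j} _ → cong (_≡ᵇ j) (f≗g j)

permEqᵇ-blockSum : ∀ a M h g → permEqᵇ (a + M) (blockSum a h g) id ≡ permEqᵇ a h id ∧ permEqᵇ M g id
permEqᵇ-blockSum a M h g = begin
    all E (upTo (a + M))
  ≡⟨ cong (all E) (applyUpTo-+ id a M) ⟩
    all E (upTo a ++ applyUpTo (a +_) M)
  ≡⟨ all-++ E (upTo a) _ ⟩
    all E (upTo a) ∧ all E (applyUpTo (a +_) M)
  ≡⟨ cong₂ _∧_ (all-applyUpTo-cong id id a λ {j} j<a → cong (_≡ᵇ j) (blockSum-below a h g j<a))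
               (all-applyUpTo-cong (a +_) id M λ {x} _ →
                  trans (cong (_≡ᵇ a + x) (blockSum-above a h g x)) (+-≡ᵇ a _ x)) ⟩
    permEqᵇ a h id ∧ permEqᵇ M g id
  ∎
  where
  E = λ i → blockSum a h g i ≡ᵇ i

-- Rotations and the standard permutation

-- By definition stdPerm (a ∷ β) is blockSum a (rotation a) (stdPerm β).
rotation : ℕ → ℕ → ℕ
rotation a i = if suc i <ᵇ a then suc i else zero

suc-%-% : ∀ m n .{{_ : NonZero n}} → suc (m % n) % n ≡ suc m % n
suc-%-% m n = begin
  (1 + m % n) % n         ≡⟨ %-distribˡ-+ 1 (m % n) n ⟩
  (1 % n + m % n % n) % n ≡⟨ cong (λ t → (1 % n + t) % n) (m%n%n≡m%n m n) ⟩
  (1 % n + m % n) % n     ≡⟨ %-distribˡ-+ 1 m n ⟨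
  (1 + m) % n             ∎

rotation-≡-suc-% : ∀ {a i} .{{_ : NonZero a}} → i < a → rotation a i ≡ suc i % a
rotation-≡-suc-% {a} {i} i<a with suc i <ᵇ a in eq
... | true  = sym (m<n⇒m%n≡m (<ᵇ⇒< (suc i) a (subst T (sym eq) tt)))
... | false = sym (trans (cong (_% a) 1+i≡a) (n%n≡0 a))
  where
  1+i≡a : suc i ≡ a
  1+i≡a = ≤-antisym i<a (≮⇒≥ (λ 1+i<a → subst T eq (<⇒<ᵇ 1+i<a)))

iter-rotation : ∀ {a i} .{{_ : NonZero a}} → i < a → ∀ k → iter (rotation a) k i ≡ (i + k) % a
iter-rotation {a} {i} i<a zero = sym (trans (cong (_% a) (+-identityʳ i)) (m<n⇒m%n≡m i<a))
iter-rotation {a} {i} i<a (suc k) = begin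
  rotation a (iter (rotation a) k i) ≡⟨ cong (rotation a) (iter-rotation i<a k) ⟩
  rotation a ((i + k) % a)           ≡⟨ rotation-≡-suc-% (m%n<n (i + k) a) ⟩
  suc ((i + k) % a) % a              ≡⟨ suc-%-% (i + k) a ⟩
  suc (i + k) % a                    ≡⟨ cong (_% a) (+-suc i k) ⟨
  (i + suc k) % a                    ∎

iter-rotation-* : ∀ {a i} .{{_ : NonZero a}} → i < a → ∀ q → iter (rotation a) (q * a) i ≡ i
iter-rotation-* {a} {i} i<a q =
  trans (iter-rotation i<a (q * a)) (trans ([m+kn]%n≡m%n i q a) (m<n⇒m%n≡m i<a))

Permutes-rotation : ∀ {a} .{{_ : NonZero a}} → Permutes a (rotation a)
Permutes-rotation {a} .closed {i} i<a = subst (_< a) (sym (rotation-≡-suc-% i<a)) (m%n<n (suc i) a)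
Permutes-rotation {a} .periodic {i} i<a = pred a , m≤pred[n]⇒suc[m]≤n ≤-refl , (begin
  iter (rotation a) (suc (pred a)) i ≡⟨ cong (λ t → iter (rotation a) t i) (suc-pred a) ⟩
  iter (rotation a) a i              ≡⟨ iter-rotation i<a a ⟩
  (i + a) % a                        ≡⟨ [m+n]%n≡m%n i a ⟩
  i % a                              ≡⟨ m<n⇒m%n≡m i<a ⟩
  i                                  ∎)

permEqᵇ-rotation-∣ : ∀ {a m} .{{_ : NonZero a}} → a ∣ m → T (permEqᵇ a (iter (rotation a) m) id)
permEqᵇ-rotation-∣ {a} (divides q refl) =
  all⁻ _ (applyUpTo⁺₁ id a λ i<a → ≡⇒≡ᵇ _ _ (iter-rotation-* i<a q))

Permutes-stdPerm : ∀ {β} → All (0 <_) β → Permutes (sum β) (stdPerm β)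
Permutes-stdPerm []            = record { closed = λ (); periodic = λ () }
Permutes-stdPerm (s≤s _ ∷ pos) = Permutes-blockSum Permutes-rotation (Permutes-stdPerm pos)

cycleType-stdPerm : ∀ {β} → All (0 <_) β → ∀ k →
  cycleType (iter (stdPerm β) k) (sum β) ≡ concatMap (λ a → cycleType (iter (rotation a) k) a) β
cycleType-stdPerm []                          k = refl
cycleType-stdPerm {a@(suc _) ∷ β} (_ ∷ pos) k = begin
    cycleType (iter (stdPerm (a ∷ β)) k) (a + sum β)
  ≡⟨ cycleType-≗ (a + sum β) (iter-blockSum a (rotation a) (stdPerm β) (Permutes-rotation .closed) k) ⟩
    cycleType (blockSum a (iter (rotation a) k) (iter (stdPerm β) k)) (a + sum β)
  ≡⟨ cycleType-blockSum (Permutes-iter Permutes-rotation k) (Permutes-iter (Permutes-stdPerm pos) k) ⟩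
    cycleType (iter (rotation a) k) a ++ cycleType (iter (stdPerm β) k) (sum β)
  ≡⟨ cong (cycleType (iter (rotation a) k) a ++_) (cycleType-stdPerm pos k) ⟩
    concatMap (λ a → cycleType (iter (rotation a) k) a) (a ∷ β)
  ∎

permEqᵇ-stdPerm : ∀ {β} → All (0 <_) β → ∀ m →
  permEqᵇ (sum β) (iter (stdPerm β) m) id ≡ all (λ a → permEqᵇ a (iter (rotation a) m) id) β
permEqᵇ-stdPerm []                          m = refl
permEqᵇ-stdPerm {a@(suc _) ∷ β} (_ ∷ pos) m = begin
    permEqᵇ (a + sum β) (iter (stdPerm (a ∷ β)) m) id
  ≡⟨ permEqᵇ-≗ (a + sum β) (iter-blockSum a (rotation a) (stdPerm β) (Permutes-rotation .closed) m) ⟩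
    permEqᵇ (a + sum β) (blockSum a (iter (rotation a) m) (iter (stdPerm β) m)) id
  ≡⟨ permEqᵇ-blockSum a (sum β) (iter (rotation a) m) (iter (stdPerm β) m) ⟩
    permEqᵇ a (iter (rotation a) m) id ∧ permEqᵇ (sum β) (iter (stdPerm β) m) id
  ≡⟨ cong (permEqᵇ a (iter (rotation a) m) id ∧_) (permEqᵇ-stdPerm pos m) ⟩
    all (λ a → permEqᵇ a (iter (rotation a) m) id) (a ∷ β)
  ∎

permEqᵇ-rotations-! : ∀ {β N} → All (0 <_) β → sum β ≤ N →
                      T (all (λ a → permEqᵇ a (iter (rotation a) (N !)) id) β)
permEqᵇ-rotations-! []                                  _     = tt
permEqᵇ-rotations-! {a@(suc b) ∷ β} {N} (_ ∷ pos) a+β≤N =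
  Equivalence.from T-∧
    ( permEqᵇ-rotation-∣ (∣-trans (m∣m*n {a} (b !)) (m≤n⇒m!∣n! (m+n≤o⇒m≤o a a+β≤N)))
    , permEqᵇ-rotations-! pos (m+n≤o⇒n≤o a a+β≤N))

-- The partition αʳ

All-^ᵖ : ∀ {P : ℕ → Set} {α} → All P α → ∀ r → All P (α ^ᵖ r)
All-^ᵖ Pα r = concat⁺ (map⁺ (All.map (replicate⁺ r) Pα))

sum-replicate : ∀ r a → sum (replicate r a) ≡ r * a
sum-replicate zero    a = refl
sum-replicate (suc r) a = cong (a +_) (sum-replicate r a)

sum-^ᵖ : ∀ α r → sum (α ^ᵖ r) ≡ r * sum α
sum-^ᵖ []      r = sym (*-zeroʳ r)
sum-^ᵖ (a ∷ α) r = begin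
  sum (replicate r a ++ α ^ᵖ r)         ≡⟨ sum-++ (replicate r a) (α ^ᵖ r) ⟩
  sum (replicate r a) + sum (α ^ᵖ r)    ≡⟨ cong₂ _+_ (sum-replicate r a) (sum-^ᵖ α r) ⟩
  r * a + r * sum α                     ≡⟨ *-distribˡ-+ r a (sum α) ⟨
  r * (a + sum α)                       ∎

^ᵖ-zero : ∀ xs → xs ^ᵖ 0 ≡ []
^ᵖ-zero []       = refl
^ᵖ-zero (x ∷ xs) = ^ᵖ-zero xs

all-replicate : ∀ (p : ℕ → Bool) r a → all p (replicate (suc r) a) ≡ p a
all-replicate p zero    a = ∧-identityʳ (p a)
all-replicate p (suc r) a = trans (cong (p a ∧_) (all-replicate p r a)) (∧-idem (p a))

all-^ᵖ : ∀ (p : ℕ → Bool) α r → all p (α ^ᵖ suc r) ≡ all p α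
all-^ᵖ p []      r = refl
all-^ᵖ p (a ∷ α) r = begin
  all p (replicate (suc r) a ++ α ^ᵖ suc r)       ≡⟨ all-++ p (replicate (suc r) a) (α ^ᵖ suc r) ⟩
  all p (replicate (suc r) a) ∧ all p (α ^ᵖ suc r) ≡⟨ cong₂ _∧_ (all-replicate p r a) (all-^ᵖ p α r) ⟩
  p a ∧ all p α                                   ∎

-- The two orders are found by searches bounded by (sum α)! and (sum αʳ)!; both searches succeed
-- below (sum α)!, because every part of α divides it.
order-stdPerm-^ᵖ : ∀ {α} → All (0 <_) α → ∀ r →
  order (stdPerm (α ^ᵖ suc r)) (sum (α ^ᵖ suc r)) ≡ order (stdPerm α) (sum α)
order-stdPerm-^ᵖ {α} pos r = cong suc (begin
    findFirst (N′ !) (λ k → permEqᵇ N′ (iter (stdPerm (α ^ᵖ suc r)) (suc k)) id)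
  ≡⟨ findFirst-cong (N′ !) (λ k → trans (permEqᵇ-stdPerm (All-^ᵖ pos (suc r)) (suc k)) (all-^ᵖ _ α r)) ⟩
    findFirst (N′ !) rotationsIdentity
  ≡⟨ findFirst-extend rotationsIdentity (m≤pred[n]⇒suc[m]≤n ≤-refl) witness (∣⇒≤ (m≤n⇒m!∣n! N≤N′)) ⟩
    findFirst (N !) rotationsIdentity
  ≡⟨ findFirst-cong (N !) (λ k → sym (permEqᵇ-stdPerm pos (suc k))) ⟩
    findFirst (N !) (λ k → permEqᵇ N (iter (stdPerm α) (suc k)) id)
  ∎)
  where
  N N′ : ℕ
  N  = sum α
  N′ = sum (α ^ᵖ suc r)
  instance
    N!≢0  = N !≢0
    N′!≢0 = N′ !≢0
  N≤N′ : N ≤ N′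
  N≤N′ = subst (N ≤_) (sym (sum-^ᵖ α (suc r))) (m≤m+n N (r * N))
  rotationsIdentity : ℕ → Bool
  rotationsIdentity k = all (λ a → permEqᵇ a (iter (rotation a) (suc k)) id) α
  witness : T (rotationsIdentity (pred (N !)))
  witness = subst (λ m → T (all (λ a → permEqᵇ a (iter (rotation a) m) id) α))
                  (sym (suc-pred (N !))) (permEqᵇ-rotations-! pos ≤-refl)

-- Multiplicities

infix 4 _∼_

_∼_ : List ℕ → List ℕ → Set
xs ∼ ys = ∀ j → mult j xs ≡ mult j ys

mult-++ : ∀ j xs ys → mult j (xs ++ ys) ≡ mult j xs + mult j ys
mult-++ j []       ys = refl
mult-++ j (x ∷ xs) ys with j ≡ᵇ x
... | true  = cong suc (mult-++ j xs ys)
... | false = mult-++ j xs ys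

mult-∉ : ∀ {j xs} → j ∉ xs → mult j xs ≡ 0
mult-∉ {j} {[]}     _   = refl
mult-∉ {j} {x ∷ xs} j∉ with j ≡ᵇ x in eq
... | true  = contradiction (here (≡ᵇ⇒≡ j x (subst T (sym eq) tt))) j∉
... | false = mult-∉ (j∉ ∘ there)

mult-concatMap-replicate : ∀ j (F : ℕ → List ℕ) r a →
                           mult j (concatMap F (replicate r a)) ≡ r * mult j (F a)
mult-concatMap-replicate j F zero    a = refl
mult-concatMap-replicate j F (suc r) a =
  trans (mult-++ j (F a) _) (cong (mult j (F a) +_) (mult-concatMap-replicate j F r a))

mult-concatMap-^ᵖ : ∀ j (F : ℕ → List ℕ) α r →
                    mult j (concatMap F (α ^ᵖ r)) ≡ r * mult j (concatMap F α)
mult-concatMap-^ᵖ j F []      r = sym (*-zeroʳ r)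
mult-concatMap-^ᵖ j F (a ∷ α) r = begin
    mult j (concatMap F (replicate r a ++ α ^ᵖ r))
  ≡⟨ cong (mult j) (concatMap-++ F (replicate r a) (α ^ᵖ r)) ⟩
    mult j (concatMap F (replicate r a) ++ concatMap F (α ^ᵖ r))
  ≡⟨ mult-++ j (concatMap F (replicate r a)) _ ⟩
    mult j (concatMap F (replicate r a)) + mult j (concatMap F (α ^ᵖ r))
  ≡⟨ cong₂ _+_ (mult-concatMap-replicate j F r a) (mult-concatMap-^ᵖ j F α r) ⟩
    r * mult j (F a) + r * mult j (concatMap F α)
  ≡⟨ *-distribˡ-+ r (mult j (F a)) _ ⟨
    r * (mult j (F a) + mult j (concatMap F α))
  ≡⟨ cong (r *_) (mult-++ j (F a) (concatMap F α)) ⟨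
    r * mult j (concatMap F (a ∷ α))
  ∎

mult-^ᵖ : ∀ j xs r → mult j (xs ^ᵖ r) ≡ r * mult j xs
mult-^ᵖ j xs r = begin
  mult j (xs ^ᵖ r)                   ≡⟨ cong (mult j) (concatMap-pure (xs ^ᵖ r)) ⟨
  mult j (concatMap [_] (xs ^ᵖ r))   ≡⟨ mult-concatMap-^ᵖ j [_] xs r ⟩
  r * mult j (concatMap [_] xs)      ≡⟨ cong (λ ys → r * mult j ys) (concatMap-pure xs) ⟩
  r * mult j xs                      ∎

concatMap-^ᵖ : ∀ (F : ℕ → List ℕ) α r → concatMap F α ^ᵖ r ∼ concatMap F (α ^ᵖ r)
concatMap-^ᵖ F α r j = trans (mult-^ᵖ j (concatMap F α) r) (sym (mult-concatMap-^ᵖ j F α r))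

sameMultisetᵇ-sound : ∀ xs ys → T (sameMultisetᵇ xs ys) → xs ∼ ys
sameMultisetᵇ-sound xs ys h j with j ∈? xs ++ ys
... | yes j∈ = ≡ᵇ⇒≡ _ _ (All.lookup (all⁺ _ (xs ++ ys) h) j∈)
... | no  j∉ = trans (mult-∉ (j∉ ∘ ∈-++⁺ˡ {ys = ys})) (sym (mult-∉ (j∉ ∘ ∈-++⁺ʳ xs)))

sameMultisetᵇ-complete : ∀ xs ys → xs ∼ ys → T (sameMultisetᵇ xs ys)
sameMultisetᵇ-complete xs ys xs∼ys = all⁻ _ (All.universal (λ j → ≡⇒≡ᵇ _ _ (xs∼ys j)) (xs ++ ys))

sameMultisetᵇ-resp : ∀ {xs ys} zs → xs ∼ ys → sameMultisetᵇ xs zs ≡ sameMultisetᵇ ys zs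
sameMultisetᵇ-resp {xs} {ys} zs xs∼ys = T-injective (mk⇔
  (λ h → sameMultisetᵇ-complete ys zs λ j → trans (sym (xs∼ys j)) (sameMultisetᵇ-sound xs zs h j))
  (λ h → sameMultisetᵇ-complete xs zs λ j → trans (xs∼ys j) (sameMultisetᵇ-sound ys zs h j)))

cycleTypes : List ℕ → ℕ → List ℕ
cycleTypes β k = cycleType (iter (stdPerm β) k) (sum β)

cycleTypes-^ᵖ : ∀ {α} → All (0 <_) α → ∀ r k → cycleTypes α k ^ᵖ r ∼ cycleTypes (α ^ᵖ r) k
cycleTypes-^ᵖ {α} pos r k j = begin
  mult j (cycleTypes α k ^ᵖ r)
    ≡⟨ cong (λ xs → mult j (xs ^ᵖ r)) (cycleType-stdPerm pos k) ⟩
  mult j (concatMap D α ^ᵖ r)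
    ≡⟨ concatMap-^ᵖ D α r j ⟩
  mult j (concatMap D (α ^ᵖ r))
    ≡⟨ cong (mult j) (cycleType-stdPerm (All-^ᵖ pos r) k) ⟨
  mult j (cycleTypes (α ^ᵖ r) k)
    ∎
  where
  D : ℕ → List ℕ
  D a = cycleType (iter (rotation a) k) a

-- Coefficients and plethysm

1+fromℤ : ∀ n → 1ℚ ℚ.+ fromℤ (ℤ.+ n) ≡ fromℤ (ℤ.+ suc n)
1+fromℤ n = trans (ℚP./-cong {q₁ = 1} (cong (ℤ._+_ ℤ.1ℤ) (ℤP.*-identityʳ (ℤ.+ n))) refl)
                  (ℚP.normalize-coprime (coprime-sym (1-coprimeTo (suc n))))

fromℤ-*-inv : ∀ n → fromℤ (ℤ.+ suc n) ℚ.* inv (suc n) ≡ 1ℚ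
fromℤ-*-inv n = trans (cong (fromℤ (ℤ.+ suc n) ℚ.*_) (ℚP.normalize-coprime (1-coprimeTo (suc n))))
                      (ℚP.*-inverseʳ (fromℤ (ℤ.+ suc n)))

-- C β is average (order (stdPerm β) (sum β)) (cycleTypes β) by definition.
average : ℕ → (ℕ → List ℕ) → Sym
average o X = map (λ k → (inv o , X k)) (upTo o)

average-cong : ∀ {o} {X Y : ℕ → List ℕ} → (∀ k → X k ∼ Y k) → average o X ≈ average o Y
average-cong {o} {X} {Y} X∼Y μ = go (upTo o)
  where
  go : ∀ ks → coeff μ (map (λ k → (inv o , X k)) ks) ≡ coeff μ (map (λ k → (inv o , Y k)) ks)
  go []       = refl
  go (k ∷ ks) = cong₂ (λ b c → if b then inv o ℚ.+ c else c)
                      (sameMultisetᵇ-resp {X k} {Y k} μ (X∼Y k)) (go ks)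

coeff-map-const-match : ∀ {μ c xs} → T (sameMultisetᵇ xs μ) → ∀ (ks : List ℕ) →
                        coeff μ (map (λ _ → (c , xs)) ks) ≡ fromℤ (ℤ.+ length ks) ℚ.* c
coeff-map-const-match {c = c} _ [] = sym (ℚP.*-zeroˡ c)
coeff-map-const-match {μ} {c} {xs} match (_ ∷ ks) rewrite Equivalence.to T-≡ match = begin
  c ℚ.+ coeff μ (map (λ _ → (c , xs)) ks)   ≡⟨ cong (c ℚ.+_) (coeff-map-const-match match ks) ⟩
  c ℚ.+ n ℚ.* c                            ≡⟨ cong (ℚ._+ n ℚ.* c) (ℚP.*-identityˡ c) ⟨
  1ℚ ℚ.* c ℚ.+ n ℚ.* c                     ≡⟨ ℚP.*-distribʳ-+ c 1ℚ n ⟨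
  (1ℚ ℚ.+ n) ℚ.* c                         ≡⟨ cong (ℚ._* c) (1+fromℤ (length ks)) ⟩
  fromℤ (ℤ.+ suc (length ks)) ℚ.* c          ∎
  where
  n = fromℤ (ℤ.+ length ks)

coeff-map-const-mismatch : ∀ {μ c xs} → sameMultisetᵇ xs μ ≡ false → ∀ (ks : List ℕ) →
                           coeff μ (map (λ _ → (c , xs)) ks) ≡ 0ℚ
coeff-map-const-mismatch _ [] = refl
coeff-map-const-mismatch mismatch (_ ∷ ks) rewrite mismatch = coeff-map-const-mismatch mismatch ks

coeff-average-const : ∀ m xs μ →
  coeff μ (average (suc m) (λ _ → xs)) ≡ (if sameMultisetᵇ xs μ then 1ℚ else 0ℚ)
coeff-average-const m xs μ = by-cases (sameMultisetᵇ xs μ) refl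
  where
  by-cases : ∀ b → sameMultisetᵇ xs μ ≡ b →
             coeff μ (average (suc m) (λ _ → xs)) ≡ (if b then 1ℚ else 0ℚ)
  by-cases true  match = begin
    coeff μ (average (suc m) (λ _ → xs))
      ≡⟨ coeff-map-const-match {μ} {inv (suc m)} (subst T (sym match) tt) (upTo (suc m)) ⟩
    fromℤ (ℤ.+ length (upTo (suc m))) ℚ.* inv (suc m)
      ≡⟨ cong (λ l → fromℤ (ℤ.+ l) ℚ.* inv (suc m)) (length-applyUpTo id (suc m)) ⟩
    fromℤ (ℤ.+ suc m) ℚ.* inv (suc m)
      ≡⟨ fromℤ-*-inv m ⟩
    1ℚ
      ∎
  by-cases false mismatch = coeff-map-const-mismatch {μ} {inv (suc m)} mismatch (upTo (suc m))

average-const : ∀ m n xs → average (suc m) (λ _ → xs) ≈ average (suc n) (λ _ → xs)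
average-const m n xs μ = trans (coeff-average-const m xs μ) (sym (coeff-average-const n xs μ))

pλ∘-p1^ : ∀ λ′ r → pλ∘ λ′ (p1^ r) ≡ pw (λ′ ^ᵖ r)
pλ∘-p1^ []       r = refl
pλ∘-p1^ (k ∷ λ′) r rewrite pλ∘-p1^ λ′ r | map-replicate (k *_) r 1 | *-identityʳ k = refl

∘ₚ-p1^ : ∀ f r → f ∘ₚ p1^ r ≡ map (map₂ (_^ᵖ r)) f
∘ₚ-p1^ []             r = refl
∘ₚ-p1^ ((c , λ′) ∷ f) r rewrite pλ∘-p1^ λ′ r | ℚP.*-identityʳ c = cong (_ ∷_) (∘ₚ-p1^ f r)

average-∘ₚ-p1^ : ∀ o X r → average o X ∘ₚ p1^ r ≡ average o (λ k → X k ^ᵖ r)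
average-∘ₚ-p1^ o X r = trans (∘ₚ-p1^ (average o X) r) (sym (map-∘ (upTo o)))

mainTheorem3 : (n : ℕ) (α : List ℕ) → IsPartitionOf n α → (r : ℕ) →
    (C α ∘ₚ p1^ r) ≈ C (α ^ᵖ r)
mainTheorem3 _ α _ zero μ = begin
    coeff μ (C α ∘ₚ p1^ 0)
  ≡⟨ cong (coeff μ) (average-∘ₚ-p1^ o (cycleTypes α) 0) ⟩
    coeff μ (average o (λ k → cycleTypes α k ^ᵖ 0))
  ≡⟨ average-cong {o} {Y = λ _ → []} (λ k j → cong (mult j) (^ᵖ-zero (cycleTypes α k))) μ ⟩
    coeff μ (average o (λ _ → []))
  ≡⟨ average-const (pred o) 0 [] μ ⟩
    coeff μ (C [])
  ≡⟨ cong (coeff μ ∘ C) (^ᵖ-zero α) ⟨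
    coeff μ (C (α ^ᵖ 0))
  ∎
  where
  o = order (stdPerm α) (sum α)
mainTheorem3 _ α isPartition (suc r) μ = begin
    coeff μ (C α ∘ₚ p1^ (suc r))
  ≡⟨ cong (coeff μ) (average-∘ₚ-p1^ o (cycleTypes α) (suc r)) ⟩
    coeff μ (average o (λ k → cycleTypes α k ^ᵖ suc r))
  ≡⟨ average-cong {o} {Y = cycleTypes (α ^ᵖ suc r)} (cycleTypes-^ᵖ pos (suc r)) μ ⟩
    coeff μ (average o (cycleTypes (α ^ᵖ suc r)))
  ≡⟨ cong (λ o′ → coeff μ (average o′ (cycleTypes (α ^ᵖ suc r)))) (order-stdPerm-^ᵖ pos r) ⟨
    coeff μ (C (α ^ᵖ suc r))
  ∎
  where
  pos = IsPartitionOf.positive isPartition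
  o = order (stdPerm α) (sum α)
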